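{- Let $G$ be a graph and let $X_1,\dots,X_m$ be distinct color classes of a vertex-coloring $\lambda$ that is $1$-stable on $G$, such that $E_G(X_i,X_{i+1}) \neq \emptyset$ for all $i\in[m-1]$. Let $B_i \subseteq X_i$ for all $i \in [m]$ and define $b := \sum_{i \in [m]}\frac{|B_i|}{|X_i|}$. Suppose that $b < 1$. Then there exists a path $u_1,\dots,u_m$ in $G$ such that $u_i \in X_i \setminus B_i$ for all $i \in [m]$.
   Context: $E_G(A,B)=\{vw\in E(G)\mid v\in A,w\in B\}$. A vertex-coloring $\lambda$ of $G$ is $1$-stable on $G$ if one round of Color Refinement does not refine it, i.e., any two vertices of the same $\lambda$-color have, for every color $c$, the same number of neighbors of color $c$. A path is a sequence of distinct vertices in which consecutive vertices are adjacent. -}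

module Defs where

open import Data.Nat using (ℕ; zero; suc)
open import Data.Bool using (Bool; true; false)
open import Data.Fin using (Fin; toℕ)
import Data.Fin
open import Data.Fin.Properties using (_≟_)
open import Data.Fin.Subset using (Subset; _∩_; ∣_∣)
open import Data.Vec using (tabulate)
open import Data.Integer using (+_)
open import Data.Rational using (ℚ; 0ℚ; _/_; _+_)
open import Relation.Nullary.Decidable using (⌊_⌋)
open import Relation.Binary.PropositionalEquality using (_≡_)

record Graph (n : ℕ) : Set where
  field
    adj    : Fin n → Fin n → Bool
    sym    : ∀ v w → adj v w ≡ adj w v
    irrefl : ∀ v → adj v v ≡ false
open Graph public

N : ∀ {n} → Graph n → Fin n → Subset n
N G v = tabulate (λ w → adj G v w)

colorClass : ∀ {n k} → (Fin n → Fin k) → Fin k → Subset n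
colorClass col c = tabulate (λ w → ⌊ col w ≟ c ⌋)

OneStable : ∀ {n k} → Graph n → (Fin n → Fin k) → Set
OneStable {n} {k} G col =
  ∀ (v w : Fin n) → col v ≡ col w → ∀ (c : Fin k) →
  ∣ N G v ∩ colorClass col c ∣ ≡ ∣ N G w ∩ colorClass col c ∣

-- a / b as a rational (b = 0 never occurs in our use since color classes are nonempty).
frac : ℕ → ℕ → ℚ
frac a zero    = 0ℚ
frac a (suc d) = (+ a) / suc d

sumℚ : ∀ {m} → (Fin m → ℚ) → ℚ
sumℚ {zero}  f = 0ℚ
sumℚ {suc m} f = f Fin.zero + sumℚ (λ i → f (Fin.suc i))

-- Call v a start of the classes X₁,…,X_m if some walk v = u₁,…,u_m has u_i ∈ X_i ∖ B_i for all i.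
-- The starts S_i of the tail X_i,…,X_m satisfy S_m = X_m ∖ B_m and S_i = (X_i ∩ N(S_{i+1})) ∖ B_i.
-- By 1-stability the edges between two consecutive classes X, Y form a biregular bipartite graph,
-- and double counting its edges shows |T|/|Y| ≤ |X ∩ N(T)|/|X| for every T ⊆ Y. So from one class
-- to the previous one the density of starts drops by at most |B_i|/|X_i|, whence
-- |S₁|/|X₁| ≥ 1 − b > 0. The walk from a start is a path because its vertices have distinct colours.
module Submission where

open import Defs hiding (sym)
open import Data.Nat using (ℕ; zero; suc; _+_; _*_; _≤_; _<_; z≤n; s≤s; >-nonZero)
open import Data.Nat.Properties
  using (≤-reflexive; ≤-trans; ≤-<-trans; +-mono-≤; +-monoʳ-≤; *-monoˡ-≤; *-monoʳ-≤; *-identityˡ;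
         *-identityʳ; *-zeroʳ; *-assoc; +-suc; n≤1+n; *-cancelʳ-≤; suc-injective; +-*-semiring;
         *-commutativeSemigroup; module ≤-Reasoning)
open import Algebra.Properties.CommutativeSemigroup *-commutativeSemigroup using (x∙yz≈y∙xz)
open import Algebra.Properties.Semiring.Sum +-*-semiring using (sum-syntax; sum-cong-≗; ∑-comm; *-distribˡ-sum)
open import Data.Bool using (Bool; true; false; _∧_)
open import Data.Bool.Properties using (∧-identityʳ; ∧-zeroʳ; T-≡)
open import Data.Fin using (Fin; toℕ)
import Data.Fin as Fin
open import Data.Fin.Patterns using (0F; 1F)
open import Data.Fin.Properties using (_≟_)
open import Data.Fin.Subset using (Subset; _∈_; _∉_; _⊆_; _∩_; ∁; ∣_∣; Nonempty; Empty)
open import Data.Fin.Subset.Properties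
  using (nonempty?; Empty-unique; ∣⊥∣≡0; p⊆q⇒∣p∣≤∣q∣; x∈p⇒∣p-x∣<∣p∣; x∈p∩q⁺; x∈p∩q⁻; p∩q⊆p;
         x∈∁p⇒x∉p; drop-there)
open import Data.Vec using ([]; _∷_; lookup; tabulate; here; there)
open import Data.Vec.Properties using (lookup∘tabulate; []=⇒lookup; lookup⇒[]=)
import Data.Vec.Functional as Vector
open import Data.Integer as ℤ using (+_)
import Data.Integer.Properties as ℤ
import Data.Integer.Tactic.RingSolver as ℤ
open import Data.Rational as ℚ using (0ℚ; 1ℚ)
import Data.Rational.Properties as ℚ
import Data.Rational.Unnormalised as ℚᵘ
import Data.Rational.Unnormalised.Properties as ℚᵘ
open import Data.Product using (_×_; ∃-syntax; _,_; proj₁; proj₂)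
open import Function using (_∘_; Equivalence)
open import Function.Definitions using (Injective)
open import Relation.Nullary.Decidable using (⌊_⌋; toWitness; fromWitness; decidable-stable)
open import Relation.Binary.PropositionalEquality
  using (_≡_; refl; sym; trans; cong; cong₂; subst; subst₂; module ≡-Reasoning)

frac-zero : ∀ X → frac 0 X ≡ 0ℚ
frac-zero zero    = refl
frac-zero (suc x) = ℚ.0/n≡0 (suc x)

frac-+ : ∀ a b {X} → 0 < X → frac a X ℚ.+ frac b X ≡ frac (a + b) X
frac-+ a b {suc x} _ = ℚ.toℚᵘ-injective (begin
    ℚ.toℚᵘ (frac a X ℚ.+ frac b X)             ≈⟨ ℚ.toℚᵘ-homo-+ (frac a X) (frac b X) ⟩
    ℚ.toℚᵘ (frac a X) ℚᵘ.+ ℚ.toℚᵘ (frac b X)   ≈⟨ ℚᵘ.+-cong (ℚ.toℚᵘ-fromℚᵘ a/X) (ℚ.toℚᵘ-fromℚᵘ b/X) ⟩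
    a/X ℚᵘ.+ b/X                               ≈⟨ ℚᵘ.*≡* (trans (common-denominator (+ a) (+ b) (+ X))
                                                                (cong (ℤ._* (+ X ℤ.* + X)) (sym (ℤ.pos-+ a b)))) ⟩
    ℚᵘ.mkℚᵘ (+ (a + b)) x                      ≈⟨ ℚ.toℚᵘ-fromℚᵘ (ℚᵘ.mkℚᵘ (+ (a + b)) x) ⟨
    ℚ.toℚᵘ (frac (a + b) X)                    ∎)
  where
  X = suc x
  a/X = ℚᵘ.mkℚᵘ (+ a) x
  b/X = ℚᵘ.mkℚᵘ (+ b) x
  open import Relation.Binary.Reasoning.Setoid ℚᵘ.≃-setoid
  common-denominator : ∀ A B X → (A ℤ.* X ℤ.+ B ℤ.* X) ℤ.* X ≡ (A ℤ.+ B) ℤ.* (X ℤ.* X)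
  common-denominator = ℤ.solve-∀

frac-mono : ∀ {a b X Y} → 0 < X → 0 < Y → a * X ≤ b * Y → frac a Y ℚ.≤ frac b X
frac-mono {a} {b} {suc x} {suc y} _ _ aX≤bY = ℚ.toℚᵘ-cancel-≤ (begin
    ℚ.toℚᵘ (frac a (suc y))   ≃⟨ ℚ.toℚᵘ-fromℚᵘ (ℚᵘ.mkℚᵘ (+ a) y) ⟩
    ℚᵘ.mkℚᵘ (+ a) y           ≤⟨ ℚᵘ.*≤* (subst₂ ℤ._≤_ (ℤ.pos-* a (suc x)) (ℤ.pos-* b (suc y)) (ℤ.+≤+ aX≤bY)) ⟩
    ℚᵘ.mkℚᵘ (+ b) x           ≃⟨ ℚ.toℚᵘ-fromℚᵘ (ℚᵘ.mkℚᵘ (+ b) x) ⟨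
    ℚ.toℚᵘ (frac b (suc x))   ∎)
  where open ℚᵘ.≤-Reasoning

𝟙 : Bool → ℕ
𝟙 false = 0
𝟙 true  = 1

sumOver : ∀ {n} → Subset n → (Fin n → ℕ) → ℕ
sumOver {n} S f = ∑[ v < n ] (𝟙 (lookup S v) * f v)

sumOver-cong : ∀ {n} (S : Subset n) {f g : Fin n → ℕ} → (∀ v → f v ≡ g v) → sumOver S f ≡ sumOver S g
sumOver-cong S f≗g = sum-cong-≗ (λ v → cong (𝟙 (lookup S v) *_) (f≗g v))

sumOver-≤ : ∀ {n} (S : Subset n) {f : Fin n → ℕ} {d} → (∀ {v} → v ∈ S → f v ≤ d) → sumOver S f ≤ ∣ S ∣ * d
sumOver-≤ []          f≤d = z≤n
sumOver-≤ (true ∷ S)  f≤d = +-mono-≤ (≤-trans (≤-reflexive (*-identityˡ _)) (f≤d here)) (sumOver-≤ S (f≤d ∘ there))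
sumOver-≤ (false ∷ S) f≤d = sumOver-≤ S (f≤d ∘ there)

sumOver-≡ : ∀ {n} (S : Subset n) {f : Fin n → ℕ} {d} → (∀ {v} → v ∈ S → f v ≡ d) → sumOver S f ≡ ∣ S ∣ * d
sumOver-≡ []          f≡d = refl
sumOver-≡ (true ∷ S)  f≡d = cong₂ _+_ (trans (*-identityˡ _) (f≡d here)) (sumOver-≡ S (f≡d ∘ there))
sumOver-≡ (false ∷ S) f≡d = sumOver-≡ S (f≡d ∘ there)

sumOver-∩ : ∀ {n} (S A : Subset n) {f : Fin n → ℕ} → (∀ {v} → v ∉ A → f v ≡ 0) → sumOver S f ≡ sumOver (S ∩ A) f
sumOver-∩ []      []          f≡0 = refl
sumOver-∩ (s ∷ S) (true ∷ A)  f≡0 =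
  cong₂ _+_ (cong (λ b → 𝟙 b * _) (sym (∧-identityʳ s))) (sumOver-∩ S A (f≡0 ∘ (_∘ drop-there)))
sumOver-∩ (s ∷ S) (false ∷ A) f≡0 =
  cong₂ _+_ (trans (cong (𝟙 s *_) (f≡0 λ ())) (trans (*-zeroʳ (𝟙 s)) (cong (λ b → 𝟙 b * _) (sym (∧-zeroʳ s)))))
            (sumOver-∩ S A (f≡0 ∘ (_∘ drop-there)))

sumOver-comm : ∀ {n} (S T : Subset n) (h : Fin n → Fin n → ℕ) → (∀ v w → h v w ≡ h w v) →
  sumOver S (λ v → sumOver T (h v)) ≡ sumOver T (λ w → sumOver S (h w))
sumOver-comm {n} S T h h-sym = begin
  ∑[ v < n ] (s v * ∑[ w < n ] (t w * h v w))  ≡⟨ sum-cong-≗ (λ v → *-distribˡ-sum (s v) (λ w → t w * h v w)) ⟩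
  ∑[ v < n ] ∑[ w < n ] (s v * (t w * h v w))  ≡⟨ ∑-comm (λ v w → s v * (t w * h v w)) ⟩
  ∑[ w < n ] ∑[ v < n ] (s v * (t w * h v w))  ≡⟨ sum-cong-≗ (λ w → sum-cong-≗ (λ v → rearrange v w)) ⟩
  ∑[ w < n ] ∑[ v < n ] (t w * (s v * h w v))  ≡⟨ sum-cong-≗ (λ w → *-distribˡ-sum (t w) (λ v → s v * h w v)) ⟨
  ∑[ w < n ] (t w * ∑[ v < n ] (s v * h w v))  ∎
  where
  open ≡-Reasoning
  s = 𝟙 ∘ lookup S
  t = 𝟙 ∘ lookup T
  rearrange : ∀ v w → s v * (t w * h v w) ≡ t w * (s v * h w v)
  rearrange v w = trans (x∙yz≈y∙xz (s v) (t w) (h v w)) (cong (λ x → t w * (s v * x)) (h-sym v w))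

∣x∷p∣ : ∀ {n} x (p : Subset n) → ∣ x ∷ p ∣ ≡ 𝟙 x + ∣ p ∣
∣x∷p∣ false p = refl
∣x∷p∣ true  p = refl

∣tabulate∩∣ : ∀ {n} (f : Fin n → Bool) (T : Subset n) → ∣ tabulate f ∩ T ∣ ≡ sumOver T (𝟙 ∘ f)
∣tabulate∩∣ f []      = refl
∣tabulate∩∣ f (t ∷ T) =
  trans (∣x∷p∣ (f 0F ∧ t) (tabulate (f ∘ Fin.suc) ∩ T)) (cong₂ _+_ (𝟙-∧ (f 0F) t) (∣tabulate∩∣ (f ∘ Fin.suc) T))
  where
  𝟙-∧ : ∀ a b → 𝟙 (a ∧ b) ≡ 𝟙 b * 𝟙 a
  𝟙-∧ false false = refl
  𝟙-∧ false true  = refl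
  𝟙-∧ true  false = refl
  𝟙-∧ true  true  = refl

∣p∣≤∣p∩∁q∣+∣q∣ : ∀ {n} (p q : Subset n) → ∣ p ∣ ≤ ∣ p ∩ ∁ q ∣ + ∣ q ∣
∣p∣≤∣p∩∁q∣+∣q∣ []          []          = z≤n
∣p∣≤∣p∩∁q∣+∣q∣ (true ∷ p)  (true ∷ q)  = ≤-trans (s≤s (∣p∣≤∣p∩∁q∣+∣q∣ p q)) (≤-reflexive (sym (+-suc _ _)))
∣p∣≤∣p∩∁q∣+∣q∣ (true ∷ p)  (false ∷ q) = s≤s (∣p∣≤∣p∩∁q∣+∣q∣ p q)
∣p∣≤∣p∩∁q∣+∣q∣ (false ∷ p) (true ∷ q)  = ≤-trans (∣p∣≤∣p∩∁q∣+∣q∣ p q) (+-monoʳ-≤ _ (n≤1+n _))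
∣p∣≤∣p∩∁q∣+∣q∣ (false ∷ p) (false ∷ q) = ∣p∣≤∣p∩∁q∣+∣q∣ p q

x∈p⇒0<∣p∣ : ∀ {n} {x : Fin n} {p : Subset n} → x ∈ p → 0 < ∣ p ∣
x∈p⇒0<∣p∣ x∈p = ≤-<-trans z≤n (x∈p⇒∣p-x∣<∣p∣ x∈p)

∈-tabulate⁺ : ∀ {n} {f : Fin n → Bool} {v} → f v ≡ true → v ∈ tabulate f
∈-tabulate⁺ {f = f} {v} fv≡true = lookup⇒[]= v (tabulate f) (trans (lookup∘tabulate f v) fv≡true)

∈-tabulate⁻ : ∀ {n} {f : Fin n → Bool} {v} → v ∈ tabulate f → f v ≡ true
∈-tabulate⁻ {f = f} {v} v∈ = trans (sym (lookup∘tabulate f v)) ([]=⇒lookup v∈)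

injective-via : ∀ {A B C : Set} {u : A → B} {g : B → C} {c : A → C} →
  (∀ i → g (u i) ≡ c i) → Injective _≡_ _≡_ c → Injective _≡_ _≡_ u
injective-via {u = u} {g} g∘u≗c c-inj {i} {j} uᵢ≡uⱼ =
  c-inj (trans (sym (g∘u≗c i)) (trans (cong g uᵢ≡uⱼ) (g∘u≗c j)))

Consecutive : ∀ {a ℓ} {A : Set a} {m} → (A → A → Set ℓ) → (Fin m → A) → Set ℓ
Consecutive R f = ∀ i j → toℕ j ≡ suc (toℕ i) → R (f i) (f j)

module _ {a ℓ} {A : Set a} {R : A → A → Set ℓ} where

  Consecutive-tail : ∀ {m} {f : Fin (suc m) → A} → Consecutive R f → Consecutive R (f ∘ Fin.suc)
  Consecutive-tail R-f i j j≡1+i = R-f (Fin.suc i) (Fin.suc j) (cong suc j≡1+i)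

  Consecutive-∷ : ∀ {m x} {f : Fin (suc m) → A} → R x (f 0F) → Consecutive R f → Consecutive R (x Vector.∷ f)
  Consecutive-∷ Rxf₀ R-f 0F          1F                    _     = Rxf₀
  Consecutive-∷ Rxf₀ R-f (Fin.suc i) (Fin.suc j)           j≡1+i = R-f i j (suc-injective j≡1+i)
  Consecutive-∷ Rxf₀ R-f 0F          0F                    ()
  Consecutive-∷ Rxf₀ R-f 0F          (Fin.suc (Fin.suc j)) ()
  Consecutive-∷ Rxf₀ R-f (Fin.suc i) 0F                    ()

  Consecutive-singleton : (f : Fin 1 → A) → Consecutive R f
  Consecutive-singleton f 0F 0F ()

module _ {n} (G : Graph n) where

  Adjacent : Fin n → Fin n → Set
  Adjacent v w = adj G v w ≡ true

  deg : Fin n → Subset n → ℕ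
  deg v T = ∣ N G v ∩ T ∣

  N[_] : Subset n → Subset n
  N[ T ] = tabulate (λ v → ⌊ nonempty? (N G v ∩ T) ⌋)

  deg≡sumOver : ∀ v T → deg v T ≡ sumOver T (λ w → 𝟙 (adj G v w))
  deg≡sumOver v = ∣tabulate∩∣ (adj G v)

  sumOver-deg-comm : ∀ S T → sumOver S (λ v → deg v T) ≡ sumOver T (λ w → deg w S)
  sumOver-deg-comm S T = begin
    sumOver S (λ v → deg v T)                         ≡⟨ sumOver-cong S (λ v → deg≡sumOver v T) ⟩
    sumOver S (λ v → sumOver T (λ w → 𝟙 (adj G v w))) ≡⟨ sumOver-comm S T (λ v w → 𝟙 (adj G v w)) adj-sym ⟩
    sumOver T (λ w → sumOver S (λ v → 𝟙 (adj G w v))) ≡⟨ sumOver-cong T (λ w → deg≡sumOver w S) ⟨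
    sumOver T (λ w → deg w S)                         ∎
    where
    open ≡-Reasoning
    adj-sym : ∀ v w → 𝟙 (adj G v w) ≡ 𝟙 (adj G w v)
    adj-sym v w = cong 𝟙 (Graph.sym G v w)

  deg-mono : ∀ {v T Y} → T ⊆ Y → deg v T ≤ deg v Y
  deg-mono {v} {T} T⊆Y = p⊆q⇒∣p∣≤∣q∣ λ w∈N∩T →
    let w∈N , w∈T = x∈p∩q⁻ (N G v) T w∈N∩T in x∈p∩q⁺ (w∈N , T⊆Y w∈T)

  ∈N[]⁻ : ∀ {v T} → v ∈ N[ T ] → Nonempty (N G v ∩ T)
  ∈N[]⁻ v∈N[T] = toWitness (Equivalence.from T-≡ (∈-tabulate⁻ v∈N[T]))

  ∉N[]⇒deg≡0 : ∀ {v T} → v ∉ N[ T ] → deg v T ≡ 0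
  ∉N[]⇒deg≡0 {v} {T} v∉N[T] = trans (cong ∣_∣ (Empty-unique empty)) (∣⊥∣≡0 n)
    where
    empty : Empty (N G v ∩ T)
    empty nonempty = v∉N[T] (∈-tabulate⁺ (Equivalence.to T-≡ (fromWitness nonempty)))

  Expands : Subset n → Subset n → Set
  Expands X Y = ∀ {T} → T ⊆ Y → ∣ T ∣ * ∣ X ∣ ≤ ∣ X ∩ N[ T ] ∣ * ∣ Y ∣

  biregular⇒Expands : ∀ {X Y d d′} → (∀ {v} → v ∈ X → deg v Y ≡ d) → (∀ {w} → w ∈ Y → deg w X ≡ d′) →
    0 < d′ → Expands X Y
  biregular⇒Expands {X} {Y} {d} {d′} degX≡d degY≡d′ 0<d′ {T} T⊆Y =
    *-cancelʳ-≤ (∣ T ∣ * ∣ X ∣) (∣ X∩N[T] ∣ * ∣ Y ∣) d′ ⦃ >-nonZero 0<d′ ⦄ (begin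
      ∣ T ∣ * ∣ X ∣ * d′        ≡⟨ *-assoc ∣ T ∣ ∣ X ∣ d′ ⟩
      ∣ T ∣ * (∣ X ∣ * d′)      ≡⟨ x∙yz≈y∙xz ∣ T ∣ ∣ X ∣ d′ ⟩
      ∣ X ∣ * (∣ T ∣ * d′)      ≤⟨ *-monoʳ-≤ ∣ X ∣ ∣T∣*d′≤∣X∩N[T]∣*d ⟩
      ∣ X ∣ * (∣ X∩N[T] ∣ * d)  ≡⟨ x∙yz≈y∙xz ∣ X ∣ ∣ X∩N[T] ∣ d ⟩
      ∣ X∩N[T] ∣ * (∣ X ∣ * d)  ≡⟨ cong (∣ X∩N[T] ∣ *_) ∣X∣*d≡∣Y∣*d′ ⟩
      ∣ X∩N[T] ∣ * (∣ Y ∣ * d′) ≡⟨ *-assoc ∣ X∩N[T] ∣ ∣ Y ∣ d′ ⟨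
      ∣ X∩N[T] ∣ * ∣ Y ∣ * d′   ∎)
    where
    open ≤-Reasoning
    X∩N[T] = X ∩ N[ T ]
    ∣X∣*d≡∣Y∣*d′ : ∣ X ∣ * d ≡ ∣ Y ∣ * d′
    ∣X∣*d≡∣Y∣*d′ = trans (sym (sumOver-≡ X degX≡d)) (trans (sumOver-deg-comm X Y) (sumOver-≡ Y degY≡d′))
    ∣T∣*d′≤∣X∩N[T]∣*d : ∣ T ∣ * d′ ≤ ∣ X∩N[T] ∣ * d
    ∣T∣*d′≤∣X∩N[T]∣*d = begin
      ∣ T ∣ * d′                     ≡⟨ sumOver-≡ T (degY≡d′ ∘ T⊆Y) ⟨
      sumOver T (λ w → deg w X)      ≡⟨ sumOver-deg-comm T X ⟩
      sumOver X (λ v → deg v T)      ≡⟨ sumOver-∩ X N[ T ] ∉N[]⇒deg≡0 ⟩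
      sumOver X∩N[T] (λ v → deg v T) ≤⟨ sumOver-≤ X∩N[T] deg≤d ⟩
      ∣ X∩N[T] ∣ * d                 ∎
      where
      deg≤d : ∀ {v} → v ∈ X∩N[T] → deg v T ≤ d
      deg≤d v∈ = ≤-trans (deg-mono T⊆Y) (≤-reflexive (degX≡d (p∩q⊆p X N[ T ] v∈)))

  starts : ∀ {m} (X B : Fin (suc m) → Subset n) → Subset n
  starts {zero}  X B = X 0F ∩ ∁ (B 0F)
  starts {suc m} X B = (X 0F ∩ N[ starts (X ∘ Fin.suc) (B ∘ Fin.suc) ]) ∩ ∁ (B 0F)

  starts⊆ : ∀ {m} (X B : Fin (suc m) → Subset n) → starts X B ⊆ X 0F
  starts⊆ {zero}  X B = p∩q⊆p _ _
  starts⊆ {suc m} X B = p∩q⊆p _ _ ∘ p∩q⊆p _ _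

  starts-walk : ∀ {m} (X B : Fin (suc m) → Subset n) {v} → v ∈ starts X B →
    ∃[ u ] (u 0F ≡ v × Consecutive Adjacent u × (∀ i → u i ∈ X i × u i ∉ B i))
  starts-walk {zero} X B {v} v∈S
    with v∈X , v∈∁B ← x∈p∩q⁻ _ _ v∈S
    = (λ _ → v) , refl , Consecutive-singleton {R = Adjacent} _ , λ { 0F → v∈X , x∈∁p⇒x∉p v∈∁B }
  starts-walk {suc m} X B {v} v∈S
    with v∈X∩N[S′] , v∈∁B ← x∈p∩q⁻ _ _ v∈S
    with v∈X , v∈N[S′] ← x∈p∩q⁻ _ _ v∈X∩N[S′]
    with w , w∈N∩S′ ← ∈N[]⁻ v∈N[S′]
    with w∈N , w∈S′ ← x∈p∩q⁻ _ _ w∈N∩S′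
    with u , u₀≡w , walk , along ← starts-walk (X ∘ Fin.suc) (B ∘ Fin.suc) w∈S′
    = v Vector.∷ u
    , refl
    , Consecutive-∷ {R = Adjacent} (subst (Adjacent v) (sym u₀≡w) (∈-tabulate⁻ w∈N)) walk
    , λ { 0F → v∈X , x∈∁p⇒x∉p v∈∁B ; (Fin.suc i) → along i }

  starts-density : ∀ {m} (X B : Fin (suc m) → Subset n) → (∀ i → 0 < ∣ X i ∣) → Consecutive Expands X →
    1ℚ ℚ.≤ frac ∣ starts X B ∣ ∣ X 0F ∣ ℚ.+ sumℚ (λ i → frac ∣ B i ∣ ∣ X i ∣)
  starts-density {zero} X B 0<∣X∣ _ = begin
    1ℚ                                ≤⟨ frac-mono {a = 1} {Y = 1} (0<∣X∣ 0F) (s≤s z≤n) 1*x₀≤[s+b₀]*1 ⟩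
    frac (s + b₀) x₀                  ≡⟨ frac-+ s b₀ (0<∣X∣ 0F) ⟨
    frac s x₀ ℚ.+ frac b₀ x₀          ≡⟨ cong (frac s x₀ ℚ.+_) (ℚ.+-identityʳ (frac b₀ x₀)) ⟨
    frac s x₀ ℚ.+ (frac b₀ x₀ ℚ.+ 0ℚ) ∎
    where
    open ℚ.≤-Reasoning
    x₀ = ∣ X 0F ∣
    b₀ = ∣ B 0F ∣
    s  = ∣ starts X B ∣
    1*x₀≤[s+b₀]*1 : 1 * x₀ ≤ (s + b₀) * 1
    1*x₀≤[s+b₀]*1 = subst₂ _≤_ (sym (*-identityˡ x₀)) (sym (*-identityʳ (s + b₀))) (∣p∣≤∣p∩∁q∣+∣q∣ (X 0F) (B 0F))
  starts-density {suc m} X B 0<∣X∣ expands = begin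
    1ℚ                                ≤⟨ starts-density (X ∘ Fin.suc) (B ∘ Fin.suc) (0<∣X∣ ∘ Fin.suc)
                                                        (Consecutive-tail {R = Expands} expands) ⟩
    frac s′ x₁ ℚ.+ Σ′                 ≤⟨ ℚ.+-monoˡ-≤ Σ′ step ⟩
    (frac s x₀ ℚ.+ frac b₀ x₀) ℚ.+ Σ′ ≡⟨ ℚ.+-assoc (frac s x₀) (frac b₀ x₀) Σ′ ⟩
    frac s x₀ ℚ.+ (frac b₀ x₀ ℚ.+ Σ′) ∎
    where
    open ℚ.≤-Reasoning
    S′ = starts (X ∘ Fin.suc) (B ∘ Fin.suc)
    x₀ = ∣ X 0F ∣
    x₁ = ∣ X 1F ∣
    b₀ = ∣ B 0F ∣
    s  = ∣ starts X B ∣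
    s′ = ∣ S′ ∣
    Σ′ = sumℚ (λ i → frac ∣ B (Fin.suc i) ∣ ∣ X (Fin.suc i) ∣)
    s′*x₀≤[s+b₀]*x₁ : s′ * x₀ ≤ (s + b₀) * x₁
    s′*x₀≤[s+b₀]*x₁ = ≤-trans (expands 0F 1F refl (starts⊆ (X ∘ Fin.suc) (B ∘ Fin.suc)))
                              (*-monoˡ-≤ x₁ (∣p∣≤∣p∩∁q∣+∣q∣ (X 0F ∩ N[ S′ ]) (B 0F)))
    step : frac s′ x₁ ℚ.≤ frac s x₀ ℚ.+ frac b₀ x₀
    step = subst (frac s′ x₁ ℚ.≤_) (sym (frac-+ s b₀ (0<∣X∣ 0F)))
             (frac-mono (0<∣X∣ 0F) (0<∣X∣ 1F) s′*x₀≤[s+b₀]*x₁)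

  starts-nonempty : ∀ {m} (X B : Fin (suc m) → Subset n) → (∀ i → 0 < ∣ X i ∣) → Consecutive Expands X →
    sumℚ (λ i → frac ∣ B i ∣ ∣ X i ∣) ℚ.< 1ℚ → Nonempty (starts X B)
  starts-nonempty X B 0<∣X∣ expands b<1 = decidable-stable (nonempty? (starts X B)) λ empty →
    let ∣starts∣≡0 = trans (cong ∣_∣ (Empty-unique empty)) (∣⊥∣≡0 n) in
    ℚ.<-irrefl refl (begin-strict
      1ℚ                           ≤⟨ starts-density X B 0<∣X∣ expands ⟩
      frac ∣ starts X B ∣ x₀ ℚ.+ b ≡⟨ cong (λ s → frac s x₀ ℚ.+ b) ∣starts∣≡0 ⟩
      frac 0 x₀ ℚ.+ b              ≡⟨ cong (ℚ._+ b) (frac-zero x₀) ⟩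
      0ℚ ℚ.+ b                     ≡⟨ ℚ.+-identityˡ b ⟩
      b                            <⟨ b<1 ⟩
      1ℚ                           ∎)
    where
    open ℚ.≤-Reasoning
    x₀ = ∣ X 0F ∣
    b  = sumℚ (λ i → frac ∣ B i ∣ ∣ X i ∣)

  avoiding-walk : ∀ {m} (X B : Fin (suc m) → Subset n) → (∀ i → 0 < ∣ X i ∣) → Consecutive Expands X →
    sumℚ (λ i → frac ∣ B i ∣ ∣ X i ∣) ℚ.< 1ℚ →
    ∃[ u ] (Consecutive Adjacent u × (∀ i → u i ∈ X i × u i ∉ B i))
  avoiding-walk X B 0<∣X∣ expands b<1
    with _ , _ , walk , along ← starts-walk X B (proj₂ (starts-nonempty X B 0<∣X∣ expands b<1))
    = _ , walk , along

module _ {n k} {col : Fin n → Fin k} where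

  ∈colorClass⁺ : ∀ {v c} → col v ≡ c → v ∈ colorClass col c
  ∈colorClass⁺ {v} {c} colv≡c = ∈-tabulate⁺ (Equivalence.to T-≡ (fromWitness {a? = col v ≟ c} colv≡c))

  ∈colorClass⁻ : ∀ {v c} → v ∈ colorClass col c → col v ≡ c
  ∈colorClass⁻ {v} {c} v∈c = toWitness {a? = col v ≟ c} (Equivalence.from T-≡ (∈-tabulate⁻ v∈c))

  edge⇒Expands : ∀ (G : Graph n) → OneStable G col → ∀ {a b} →
    (∃[ v ] ∃[ w ] (v ∈ colorClass col a × w ∈ colorClass col b × adj G v w ≡ true)) →
    Expands G (colorClass col a) (colorClass col b)
  edge⇒Expands G stable (v , w , v∈a , w∈b , vw) =
    biregular⇒Expands G (same-deg v∈a) (same-deg w∈b) (x∈p⇒0<∣p∣ v∈N[w]∩a)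
    where
    same-deg : ∀ {c c′ x y} → x ∈ colorClass col c → y ∈ colorClass col c →
      deg G y (colorClass col c′) ≡ deg G x (colorClass col c′)
    same-deg x∈c y∈c = stable _ _ (trans (∈colorClass⁻ y∈c) (sym (∈colorClass⁻ x∈c))) _
    v∈N[w]∩a = x∈p∩q⁺ (∈-tabulate⁺ (trans (Graph.sym G w v) vw) , v∈a)

lemma4p29 : ∀ {n k m : ℕ} (G : Graph n) (col : Fin n → Fin k) →
  OneStable G col →
  (c : Fin m → Fin k) → Injective _≡_ _≡_ c →
  (∀ i → ∃[ v ] col v ≡ c i) →
  (∀ (i j : Fin m) → toℕ j ≡ suc (toℕ i) →
    ∃[ v ] ∃[ w ] (v ∈ colorClass col (c i) × w ∈ colorClass col (c j) × adj G v w ≡ true)) →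
  (B : Fin m → Subset n) → (∀ i → B i ⊆ colorClass col (c i)) →
  sumℚ (λ i → frac ∣ B i ∣ ∣ colorClass col (c i) ∣) ℚ.< 1ℚ →
  ∃[ u ] (Injective _≡_ _≡_ u
    × (∀ (i j : Fin m) → toℕ j ≡ suc (toℕ i) → adj G (u i) (u j) ≡ true)
    × (∀ i → u i ∈ colorClass col (c i) × u i ∉ B i))
lemma4p29 {m = zero} G col _ c _ _ _ B _ _ = (λ ()) , (λ { {()} }) , (λ ()) , (λ ())
lemma4p29 {m = suc m} G col stable c c-inj inhabited edges B _ b<1 =
  let u , walk , along = avoiding-walk G (colorClass col ∘ c) B classes-nonempty classes-expand b<1
  in  u , injective-via {g = col} (λ i → ∈colorClass⁻ (proj₁ (along i))) c-inj , walk , along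
  where
  classes-nonempty : ∀ i → 0 < ∣ colorClass col (c i) ∣
  classes-nonempty i = x∈p⇒0<∣p∣ (∈colorClass⁺ {col = col} (proj₂ (inhabited i)))
  classes-expand : Consecutive (Expands G) (colorClass col ∘ c)
  classes-expand i j j≡1+i = edge⇒Expands G stable (edges i j j≡1+i)
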